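{- Let $n\ge 5$ and $q\ge 1$. For $k=1,\dots,q$ define $\varphi_k:A_n^q\to A_n^q$ by $(\sigma_1,\dots,\sigma_k,\dots,\sigma_q)^{\varphi_k}=(\sigma_1,\dots,\sigma_k^{ -1},\dots,\sigma_q)$. Then $$(R(A_n^q)\rtimes(\mathrm{Inn}(S_n)\wr S_q))\rtimes Z_2^q\le\mathrm{Aut}(A\Gamma_n^q),$$ where $\mathrm{Inn}(S_n)\cong S_n$ and $Z_2^q=\langle\varphi_1\rangle\times\cdots\times\langle\varphi_q\rangle$. In particular $|\mathrm{Aut}(A\Gamma_n^q)|\ge|(R(A_n^q)\rtimes(\mathrm{Inn}(S_n)\wr S_q))\rtimes Z_2^q|=q!\,(n!)^{2q}$.
   Context: $X=\{1,\dots,n\}$; permutations act on the right. $S_n$, $A_n$ are the symmetric and alternating groups on $X$; $\mathcal{E}_n=\{\sigma\in A_n: i^\sigma\neq i \text{ for all } i\in X\}$. $A\Gamma_n^q$ is the Cayley graph $\Gamma(A_n^q,\mathcal{E}_n^q)$ (the tensor product of $q$ copies of the Cayley graph $\Gamma(A_n,\mathcal{E}_n)$): vertex set $A_n^q$, with $(\sigma_1,\dots,\sigma_q)$ adjacent to $(\tau_1,\dots,\tau_q)$ iff $i^{\sigma_k}\neq i^{\tau_k}$ for all $i\in X$ and all $k$. All groups are regarded as permutation groups on $A_n^q$: $R(A_n^q)$ is the right regular representation ($x\mapsto xg$); $\mathrm{Inn}(S_n)\wr S_q$ acts as group automorphisms of $A_n^q$, the $k$-th copy of $\mathrm{Inn}(S_n)$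 conjugating the $k$-th coordinate by an element of $S_n$ and $S_q$ permuting coordinates. -}

module Defs where

open import Data.Nat using (ℕ; _*_; _^_; _≥_)
open import Data.Nat.Divisibility using (_∣_)
open import Data.Fin using (Fin; _<?_)
open import Data.Fin.Permutation using (Permutation′; _⟨$⟩ʳ_; _∘ₚ_; flip)
open import Data.Bool using (Bool; true; false; if_then_else_)
open import Data.List using (length; filter; cartesianProduct; allFin)
open import Data.Product using (Σ; _×_; _,_; proj₁)
open import Relation.Nullary using (¬_)
open import Relation.Nullary.Decidable using (_×-dec_)
open import Relation.Binary.PropositionalEquality using (_≡_; _≢_)

-- Permutations of X = Fin n.  Permutations act on the RIGHT:
-- i^σ = σ ⟨$⟩ʳ i, and στ = σ ∘ₚ τ means "first σ, then τ"
-- (i.e. (σ ∘ₚ τ) ⟨$⟩ʳ i = τ ⟨$⟩ʳ (σ ⟨$⟩ʳ i)).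

Perm : ℕ → Set
Perm n = Permutation′ n

_≈ₚ_ : ∀ {n} → Perm n → Perm n → Set
σ ≈ₚ τ = ∀ i → σ ⟨$⟩ʳ i ≡ τ ⟨$⟩ʳ i

_⁻¹ : ∀ {n} → Perm n → Perm n
σ ⁻¹ = flip σ

_^ᶜ_ : ∀ {n} → Perm n → Perm n → Perm n
σ ^ᶜ c = (c ⁻¹) ∘ₚ (σ ∘ₚ c)

inversions : ∀ {n} → Perm n → ℕ
inversions {n} σ =
  length (filter (λ p → (proj₁' p <? snd' p) ×-dec (σ ⟨$⟩ʳ snd' p <? σ ⟨$⟩ʳ proj₁' p))
                 (cartesianProduct (allFin n) (allFin n)))
  where
    proj₁' : Fin n × Fin n → Fin n
    proj₁' (i , _) = i
    snd' : Fin n × Fin n → Fin n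
    snd' (_ , j) = j

IsEven : ∀ {n} → Perm n → Set
IsEven σ = 2 ∣ inversions σ

-- Tuples (σ₁,…,σ_q) ∈ S_n^q; A_n^q is the subset where every σ_k is even.

Tup : ℕ → ℕ → Set
Tup n q = Fin q → Perm n

InAq : ∀ {n q} → Tup n q → Set
InAq x = ∀ k → IsEven (x k)

_≈ᵗ_ : ∀ {n q} → Tup n q → Tup n q → Set
x ≈ᵗ y = ∀ k → x k ≈ₚ y k

Adj : ∀ {n q} → Tup n q → Tup n q → Set
Adj x y = ∀ k i → x k ⟨$⟩ʳ i ≢ y k ⟨$⟩ʳ i

-- f : S_n^q → S_n^q restricts to an automorphism of AΓ_n^q:
-- it maps A_n^q into A_n^q, respects equality, is injective and surjective on
-- A_n^q, and preserves adjacency and non-adjacency.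
IsAutAΓ : ∀ {n q} → (Tup n q → Tup n q) → Set
IsAutAΓ {n} {q} f =
  (∀ x → InAq x → InAq (f x)) ×
  (∀ x y → InAq x → InAq y → x ≈ᵗ y → f x ≈ᵗ f y) ×
  (∀ x y → InAq x → InAq y → f x ≈ᵗ f y → x ≈ᵗ y) ×
  (∀ y → InAq y → Σ (Tup n q) (λ x → InAq x × f x ≈ᵗ y)) ×
  (∀ x y → InAq x → InAq y → (Adj x y → Adj (f x) (f y)) × (Adj (f x) (f y) → Adj x y))

_≈ᶠ_ : ∀ {n q} → (Tup n q → Tup n q) → (Tup n q → Tup n q) → Set
_≈ᶠ_ {n} {q} f g = ∀ x → InAq x → f x ≈ᵗ g x

-- Elements of (R(A_n^q) ⋊ (Inn(S_n) ≀ S_q)) ⋊ Z_2^q, given by parameters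
--   g ∈ A_n^q,  (c₁,…,c_q) ∈ S_n^q,  π ∈ S_q,  ε ∈ {0,1}^q.

record Param (n q : ℕ) : Set where
  constructor param
  field
    g     : Tup n q
    g-even : InAq g
    c     : Tup n q
    π     : Perm q
    ε     : Fin q → Bool

R : ∀ {n q} → Tup n q → Tup n q → Tup n q
R g x k = x k ∘ₚ g k

-- element ((c₁,…,c_q); π) of Inn(S_n) ≀ S_q: conjugate the k-th coordinate by c_k,
-- then permute coordinates by π
W : ∀ {n q} → Tup n q → Perm q → Tup n q → Tup n q
W c π x k = (x (π ⟨$⟩ʳ k)) ^ᶜ (c (π ⟨$⟩ʳ k))

-- φ_k, for the set {k : ε k = true}: invert the k-th coordinate
Φ : ∀ {n q} → (Fin q → Bool) → Tup n q → Tup n q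
Φ ε x k = if ε k then (x k) ⁻¹ else x k

act : ∀ {n q} → Param n q → Tup n q → Tup n q
act p x = Φ (Param.ε p) (W (Param.c p) (Param.π p) (R (Param.g p) x))

module Submission where

-- The proof has four parts.
--  * The sign.  sgn σ is the parity of the inversion count; removing a point k
--    changes it by the parity of k + k^σ, which gives sgn (σ τ) = sgn σ + sgn τ
--    by induction.  Hence A_n is a subgroup closed under conjugation, and small
--    even permutations (3-cycles) show that for n ≥ 4 the centralizer of A_n is
--    trivial and that no conjugation inverts all of A_n.
--  * Automorphisms.  Right multiplication by an even g, conjugation and
--    inversion each induce an automorphism of Γ(A_n, derangements); composites
--    of such maps applied after permuting coordinates are automorphisms of
--    AΓ_n^q.  Testing on tuples that are the identity outside one
--    coordinate recovers π, and then on each coordinate the flag, conjugator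
--    and shift, using the two facts about A_n above.
--  * Counting.  Enumerations of S_n (n! elements), of tuples and of pairs are
--    combined; a pair (g, ε) with g even is encoded by the permutation g τ^ε,
--    so the parameters, up to giving the same automorphism, number q! (n!)^(2q).

open import Defs

open import Data.Bool using (Bool; true; false; _∧_; _xor_; not; if_then_else_)
open import Data.Fin
  using (Fin; zero; suc; toℕ; punchIn; punchOut; _≟_; combine; remQuot; finToFun; funToFin)
import Data.Fin as Fin
open import Data.Fin.Patterns using (0F; 1F; 2F; 3F)
open import Data.Fin.Permutation
  using (_⟨$⟩ʳ_; _⟨$⟩ˡ_; _∘ₚ_; remove; insert; lift₀; transpose; inverseˡ; inverseʳ;
         punchIn-permute; insert-punchIn; insert-remove; remove-insert)
import Data.Fin.Permutation as P
open import Data.Fin.Properties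
  using (punchOut-cong; punchOut-cong′; punchIn-punchOut; punchOut-punchIn;
         remQuot-combine; combine-remQuot; finToFun-funToFin; funToFin-finToFin)
open import Data.List using (List; _++_; map; length; filter; tabulate; cartesianProduct; allFin)
open import Data.List.Properties using (filter-++; length-++; map-tabulate)
open import Data.Nat using (ℕ; zero; suc; _+_; _*_; _^_; _!; _≥_; s≤s; z≤n; parity)
import Data.Nat as ℕ
open import Data.Nat.Divisibility using (_∣_; divides)
open import Data.Nat.Properties as ℕₚ using (+-assoc; +-identityʳ; ^-distribˡ-+-*)
open import Data.Nat.Tactic.RingSolver using (solve-∀)
open import Data.Parity using (Parity; 0ℙ; 1ℙ) renaming (_+_ to _⊕_)
open import Data.Parity.Properties as ℙₚ
  using (+-homo-+; *-homo-*; p+p≡0ℙ; ⁻¹-involutive)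
  renaming (+-identityʳ to ⊕-identityʳ; +-assoc to ⊕-assoc; +-comm to ⊕-comm;
            +-cancelˡ-≡ to ⊕-cancelˡ-≡; *-zeroʳ to ⊛-zeroʳ)
open import Data.Product using (Σ; _×_; _,_; proj₁; proj₂; uncurry)
open import Data.Product.Relation.Binary.Pointwise.NonDependent using (Pointwise)
open import Function using (_∘_; id)
open import Relation.Binary.PropositionalEquality
open import Relation.Nullary using (¬_; does; yes; no; contradiction)
open import Relation.Unary using (Pred; Decidable)
open ≡-Reasoning

open import Algebra.Properties.CommutativeMonoid.Sum ℕₚ.+-0-commutativeMonoid
  using (sum-syntax; sum-cong-≗; sum-remove; ∑-distrib-+; ∑-permute; sum-replicate-zero)
open import Algebra.Properties.CommutativeSemigroup ℙₚ.+-commutativeSemigroup using (x∙yz≈y∙xz)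

private
  variable
    m n : ℕ

permute-injective : (σ : Perm n) {i j : Fin n} → σ ⟨$⟩ʳ i ≡ σ ⟨$⟩ʳ j → i ≡ j
permute-injective σ {i} {j} eq = trans (sym (inverseˡ σ)) (trans (cong (σ ⟨$⟩ˡ_) eq) (inverseˡ σ))

indicator : Bool → ℕ
indicator true  = 1
indicator false = 0

length-filter-tabulate : ∀ {a p} {A : Set a} {P : Pred A p} (P? : Decidable P) (f : Fin n → A) →
  length (filter P? (tabulate f)) ≡ ∑[ i < n ] indicator (does (P? (f i)))
length-filter-tabulate {zero} P? f = refl
length-filter-tabulate {suc n} P? f with does (P? (f zero))
... | true  = cong suc (length-filter-tabulate P? (f ∘ suc))
... | false = length-filter-tabulate P? (f ∘ suc)

length-filter-cartesian : ∀ {a b p} {A : Set a} {B : Set b} {P : Pred (A × B) p} (P? : Decidable P)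
  (f : Fin m → A) (ys : List B) →
  length (filter P? (cartesianProduct (tabulate f) ys)) ≡ ∑[ i < m ] length (filter P? (map (f i ,_) ys))
length-filter-cartesian {zero} P? f ys = refl
length-filter-cartesian {suc m} P? f ys = begin
  length (filter P? (map (f zero ,_) ys ++ cartesianProduct (tabulate (f ∘ suc)) ys))
    ≡⟨ cong length (filter-++ P? (map (f zero ,_) ys) _) ⟩
  length (filter P? (map (f zero ,_) ys) ++ filter P? (cartesianProduct (tabulate (f ∘ suc)) ys))
    ≡⟨ length-++ (filter P? (map (f zero ,_) ys)) ⟩
  length (filter P? (map (f zero ,_) ys)) + length (filter P? (cartesianProduct (tabulate (f ∘ suc)) ys))
    ≡⟨ cong (length (filter P? (map (f zero ,_) ys)) +_) (length-filter-cartesian P? (f ∘ suc) ys) ⟩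
  ∑[ i < suc m ] length (filter P? (map (f i ,_) ys)) ∎

length-filter-pairs : ∀ {p} {P : Pred (Fin m × Fin n) p} (P? : Decidable P) →
  length (filter P? (cartesianProduct (allFin m) (allFin n)))
    ≡ ∑[ i < m ] ∑[ j < n ] indicator (does (P? (i , j)))
length-filter-pairs {m} {n} P? = begin
  length (filter P? (cartesianProduct (allFin m) (allFin n)))
    ≡⟨ length-filter-cartesian P? id (allFin n) ⟩
  ∑[ i < m ] length (filter P? (map (i ,_) (allFin n)))
    ≡⟨ sum-cong-≗ (λ i → cong (length ∘ filter P?) (map-tabulate id (i ,_))) ⟩
  ∑[ i < m ] length (filter P? (tabulate (i ,_)))
    ≡⟨ sum-cong-≗ (λ i → length-filter-tabulate P? (i ,_)) ⟩
  ∑[ i < m ] ∑[ j < n ] indicator (does (P? (i , j))) ∎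

-- Strict order on Fin n as a boolean; this is what the decision procedure _<?_ computes.
_<ᵇ_ : Fin n → Fin n → Bool
i <ᵇ j = toℕ i ℕ.<ᵇ toℕ j

<ᵇ-punchIn : (k : Fin (suc n)) (i j : Fin n) → punchIn k i <ᵇ punchIn k j ≡ i <ᵇ j
<ᵇ-punchIn zero    i       j       = refl
<ᵇ-punchIn (suc k) zero    zero    = refl
<ᵇ-punchIn (suc k) zero    (suc j) = refl
<ᵇ-punchIn (suc k) (suc i) zero    = refl
<ᵇ-punchIn (suc k) (suc i) (suc j) = <ᵇ-punchIn k i j

<ᵇ-irrefl : (i : Fin n) → i <ᵇ i ≡ false
<ᵇ-irrefl zero    = refl
<ᵇ-irrefl (suc i) = <ᵇ-irrefl i

<ᵇ-flip : {i j : Fin n} → i ≢ j → i <ᵇ j ≡ not (j <ᵇ i)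
<ᵇ-flip {i = zero}  {zero}  i≢j = contradiction refl i≢j
<ᵇ-flip {i = zero}  {suc j} i≢j = refl
<ᵇ-flip {i = suc i} {zero}  i≢j = refl
<ᵇ-flip {i = suc i} {suc j} i≢j = <ᵇ-flip (i≢j ∘ cong suc)

count-below : (k : Fin n) → ∑[ i < n ] indicator (i <ᵇ k) ≡ toℕ k
count-below {suc n} zero    = sum-replicate-zero n
count-below {suc n} (suc k) = cong suc (count-below k)

inversion : Perm n → Fin n → Fin n → ℕ
inversion σ i j = indicator (i <ᵇ j ∧ (σ ⟨$⟩ʳ j) <ᵇ (σ ⟨$⟩ʳ i))

Inv : Perm n → ℕ
Inv {n} σ = ∑[ i < n ] ∑[ j < n ] inversion σ i j

inversions≡Inv : (σ : Perm n) → inversions σ ≡ Inv σ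
inversions≡Inv {n} σ = length-filter-pairs {n} {n} _

indicator-split : ∀ a b → indicator (a ∧ not b) + indicator (a ∧ b) ≡ indicator a
indicator-split true  true  = refl
indicator-split true  false = refl
indicator-split false b     = refl

indicator-split′ : ∀ a b → indicator (not a ∧ b) + indicator (a ∧ b) ≡ indicator b
indicator-split′ true  b     = refl
indicator-split′ false true  = refl
indicator-split′ false false = refl

inversion-remove : (σ : Perm (suc n)) (k : Fin (suc n)) (i j : Fin n) →
  inversion σ (punchIn k i) (punchIn k j) ≡ inversion (remove k σ) i j
inversion-remove σ k i j = cong indicator (cong₂ _∧_ (<ᵇ-punchIn k i j) (begin
  (σ ⟨$⟩ʳ punchIn k j) <ᵇ (σ ⟨$⟩ʳ punchIn k i)
    ≡⟨ cong₂ _<ᵇ_ (punchIn-permute σ k j) (punchIn-permute σ k i) ⟩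
  punchIn (σ ⟨$⟩ʳ k) (remove k σ ⟨$⟩ʳ j) <ᵇ punchIn (σ ⟨$⟩ʳ k) (remove k σ ⟨$⟩ʳ i)
    ≡⟨ <ᵇ-punchIn (σ ⟨$⟩ʳ k) _ _ ⟩
  (remove k σ ⟨$⟩ʳ j) <ᵇ (remove k σ ⟨$⟩ʳ i) ∎))

-- Removing a point k: the inversions of σ split into those in the row of k,
-- those in the column of k, and those of remove k σ.  Together with the
-- pairs below k that σ keeps in order, the row counts the points σ sends
-- below k^σ and the column counts the points below k; hence, modulo 2,
-- Inv σ ≡ k + k^σ + Inv (remove k σ).
module _ (σ : Perm (suc n)) (k : Fin (suc n)) where
  kept : ℕ
  kept = ∑[ i < suc n ] indicator (i <ᵇ k ∧ (σ ⟨$⟩ʳ i) <ᵇ (σ ⟨$⟩ʳ k))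

  private
    s : Fin (suc n) → Fin (suc n)
    s i = σ ⟨$⟩ʳ i

    row col : ℕ
    row  = ∑[ j < suc n ] inversion σ k j
    col  = ∑[ i < suc n ] inversion σ i k

    Inv-split : Inv σ ≡ row + col + Inv (remove k σ)
    Inv-split = begin
      Inv σ
        ≡⟨ sum-remove {i = k} (λ i → ∑[ j < suc n ] inversion σ i j) ⟩
      row + ∑[ i < n ] ∑[ j < suc n ] inversion σ (punchIn k i) j
        ≡⟨ cong (row +_) (sum-cong-≗ (λ i → sum-remove {i = k} (inversion σ (punchIn k i)))) ⟩
      row + ∑[ i < n ] (inversion σ (punchIn k i) k + ∑[ j < n ] inversion σ (punchIn k i) (punchIn k j))
        ≡⟨ cong (row +_) (∑-distrib-+ (λ i → inversion σ (punchIn k i) k) _) ⟩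
      row + (∑[ i < n ] inversion σ (punchIn k i) k + ∑[ i < n ] ∑[ j < n ] inversion σ (punchIn k i) (punchIn k j))
        ≡⟨ cong₂ (λ a b → row + (a + b))
             (sym (trans (sum-remove {i = k} (λ i → inversion σ i k))
                         (cong (_+ ∑[ i < n ] inversion σ (punchIn k i) k) diagonal)))
             (sum-cong-≗ (λ i → sum-cong-≗ (inversion-remove σ k i))) ⟩
      row + (col + Inv (remove k σ))
        ≡⟨ sym (+-assoc row col (Inv (remove k σ))) ⟩
      row + col + Inv (remove k σ) ∎
      where
      diagonal : inversion σ k k ≡ 0
      diagonal rewrite <ᵇ-irrefl k = refl

    col+kept : col + kept ≡ toℕ k
    col+kept = begin
      col + kept
        ≡⟨ sym (∑-distrib-+ (λ i → inversion σ i k) (λ i → indicator (i <ᵇ k ∧ s i <ᵇ s k))) ⟩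
      ∑[ i < suc n ] (inversion σ i k + indicator (i <ᵇ k ∧ s i <ᵇ s k))
                                     ≡⟨ sum-cong-≗ pointwise ⟩
      ∑[ i < suc n ] indicator (i <ᵇ k) ≡⟨ count-below k ⟩
      toℕ k ∎
      where
      pointwise : ∀ i → inversion σ i k + indicator (i <ᵇ k ∧ s i <ᵇ s k) ≡ indicator (i <ᵇ k)
      pointwise i with i ≟ k
      ... | yes refl rewrite <ᵇ-irrefl i = refl
      ... | no i≢k rewrite <ᵇ-flip {i = s k} {s i} (i≢k ∘ permute-injective σ ∘ sym) =
        indicator-split (i <ᵇ k) (s i <ᵇ s k)

    row+kept : row + kept ≡ toℕ (s k)
    row+kept = begin
      row + kept
        ≡⟨ sym (∑-distrib-+ (inversion σ k) (λ i → indicator (i <ᵇ k ∧ s i <ᵇ s k))) ⟩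
      ∑[ i < suc n ] (inversion σ k i + indicator (i <ᵇ k ∧ s i <ᵇ s k))
        ≡⟨ sum-cong-≗ pointwise ⟩
      ∑[ i < suc n ] indicator (s i <ᵇ s k)
        ≡⟨ sym (∑-permute (λ j → indicator (j <ᵇ s k)) σ) ⟩
      ∑[ j < suc n ] indicator (j <ᵇ s k)
        ≡⟨ count-below (s k) ⟩
      toℕ (s k) ∎
      where
      pointwise : ∀ i → inversion σ k i + indicator (i <ᵇ k ∧ s i <ᵇ s k) ≡ indicator (s i <ᵇ s k)
      pointwise i with i ≟ k
      ... | yes refl rewrite <ᵇ-irrefl i | <ᵇ-irrefl (s i) = refl
      ... | no i≢k rewrite <ᵇ-flip {i = k} {i} (i≢k ∘ sym) = indicator-split′ (i <ᵇ k) (s i <ᵇ s k)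

  Inv-remove : Inv σ + (kept + kept) ≡ toℕ k + toℕ (s k) + Inv (remove k σ)
  Inv-remove = begin
    Inv σ + (kept + kept)                    ≡⟨ cong (_+ (kept + kept)) Inv-split ⟩
    row + col + Inv (remove k σ) + (kept + kept)
      ≡⟨ rearrange row col kept (Inv (remove k σ)) ⟩
    (col + kept) + (row + kept) + Inv (remove k σ)
      ≡⟨ cong₂ (λ a b → a + b + Inv (remove k σ)) col+kept row+kept ⟩
    toℕ k + toℕ (s k) + Inv (remove k σ) ∎
    where
    rearrange : ∀ a b c r → a + b + r + (c + c) ≡ (b + c) + (a + c) + r
    rearrange = solve-∀

sgn : Perm n → Parity
sgn σ = parity (Inv σ)

sgn-cong : (σ τ : Perm n) → σ ≈ₚ τ → sgn σ ≡ sgn τ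
sgn-cong σ τ σ≈τ = cong parity (sum-cong-≗ λ i → sum-cong-≗ λ j →
  cong₂ (λ a b → indicator (i <ᵇ j ∧ a <ᵇ b)) (σ≈τ j) (σ≈τ i))

parity-+-double : ∀ x a → parity (x + (a + a)) ≡ parity x
parity-+-double x a = begin
  parity (x + (a + a))                  ≡⟨ +-homo-+ x (a + a) ⟩
  parity x ⊕ parity (a + a)             ≡⟨ cong (parity x ⊕_) (trans (+-homo-+ a a) (p+p≡0ℙ (parity a))) ⟩
  parity x ⊕ 0ℙ                         ≡⟨ ⊕-identityʳ (parity x) ⟩
  parity x ∎

sgn-remove : (σ : Perm (suc n)) (k : Fin (suc n)) →
  sgn σ ≡ parity (toℕ k) ⊕ parity (toℕ (σ ⟨$⟩ʳ k)) ⊕ sgn (remove k σ)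
sgn-remove σ k = begin
  parity (Inv σ)                                         ≡⟨ sym (parity-+-double (Inv σ) (kept σ k)) ⟩
  parity (Inv σ + (kept σ k + kept σ k))                 ≡⟨ cong parity (Inv-remove σ k) ⟩
  parity (toℕ k + toℕ (σ ⟨$⟩ʳ k) + Inv (remove k σ))     ≡⟨ +-homo-+ (toℕ k + _) _ ⟩
  parity (toℕ k + toℕ (σ ⟨$⟩ʳ k)) ⊕ sgn (remove k σ)    ≡⟨ cong (_⊕ sgn (remove k σ)) (+-homo-+ (toℕ k) _) ⟩
  parity (toℕ k) ⊕ parity (toℕ (σ ⟨$⟩ʳ k)) ⊕ sgn (remove k σ) ∎

remove-∘ : (σ τ : Perm (suc n)) (k : Fin (suc n)) →
  remove k (σ ∘ₚ τ) ≈ₚ (remove k σ ∘ₚ remove (σ ⟨$⟩ʳ k) τ)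
remove-∘ σ τ k j = punchOut-cong′ (τ ⟨$⟩ʳ (σ ⟨$⟩ʳ k)) (cong (τ ⟨$⟩ʳ_) (sym (punchIn-punchOut _)))

remove-id : (k : Fin (suc n)) → remove k P.id ≈ₚ P.id
remove-id k j = punchOut-punchIn k

sgn-id : sgn (P.id {n}) ≡ 0ℙ
sgn-id {zero}  = refl
sgn-id {suc n} = trans (sgn-remove (P.id {suc n}) zero)
  (trans (sgn-cong (remove zero (P.id {suc n})) P.id (remove-id zero)) (sgn-id {n}))

⊕-cancel-twice : ∀ b x y → (b ⊕ x) ⊕ (b ⊕ y) ≡ x ⊕ y
⊕-cancel-twice 0ℙ x  y = refl
⊕-cancel-twice 1ℙ 0ℙ y = ⁻¹-involutive y
⊕-cancel-twice 1ℙ 1ℙ y = refl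

sgn-∘ : (σ τ : Perm n) → sgn (σ ∘ₚ τ) ≡ sgn σ ⊕ sgn τ
sgn-∘ {zero}  σ τ = refl
sgn-∘ {suc n} σ τ = begin
  sgn (σ ∘ₚ τ)                                     ≡⟨ sgn-remove (σ ∘ₚ τ) zero ⟩
  pc ⊕ sgn (remove zero (σ ∘ₚ τ))
    ≡⟨ cong (pc ⊕_) (sgn-cong (remove zero (σ ∘ₚ τ)) (remove zero σ ∘ₚ remove b τ) (remove-∘ σ τ zero)) ⟩
  pc ⊕ sgn (remove zero σ ∘ₚ remove b τ)           ≡⟨ cong (pc ⊕_) (sgn-∘ (remove zero σ) (remove b τ)) ⟩
  pc ⊕ (sgn (remove zero σ) ⊕ sgn (remove b τ))    ≡⟨ x∙yz≈y∙xz pc (sgn (remove zero σ)) (sgn (remove b τ)) ⟩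
  sgn (remove zero σ) ⊕ (pc ⊕ sgn (remove b τ))
    ≡⟨ sym (⊕-cancel-twice pb (sgn (remove zero σ)) (pc ⊕ sgn (remove b τ))) ⟩
  (pb ⊕ sgn (remove zero σ)) ⊕ (pb ⊕ (pc ⊕ sgn (remove b τ)))
    ≡⟨ cong₂ _⊕_ (sym (sgn-remove σ zero)) (trans (sym (⊕-assoc pb pc (sgn (remove b τ)))) (sym (sgn-remove τ b))) ⟩
  sgn σ ⊕ sgn τ ∎
  where
  b : Fin (suc n)
  b = σ ⟨$⟩ʳ zero
  pb pc : Parity
  pb = parity (toℕ b)
  pc = parity (toℕ (τ ⟨$⟩ʳ b))

sgn-inverse : (σ : Perm n) → sgn (σ ⁻¹) ≡ sgn σ
sgn-inverse {n} σ = ⊕-cancelˡ-≡ (sgn σ) (sgn (σ ⁻¹)) (sgn σ) (begin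
  sgn σ ⊕ sgn (σ ⁻¹)   ≡⟨ sym (sgn-∘ σ (σ ⁻¹)) ⟩
  sgn (σ ∘ₚ (σ ⁻¹))    ≡⟨ sgn-cong (σ ∘ₚ (σ ⁻¹)) P.id (λ i → inverseˡ σ) ⟩
  sgn (P.id {n})       ≡⟨ sgn-id {n} ⟩
  0ℙ                   ≡⟨ sym (p+p≡0ℙ (sgn σ)) ⟩
  sgn σ ⊕ sgn σ ∎)

sgn-conj : (σ c : Perm n) → sgn (σ ^ᶜ c) ≡ sgn σ
sgn-conj σ c = begin
  sgn (σ ^ᶜ c)                      ≡⟨ trans (sgn-∘ (c ⁻¹) (σ ∘ₚ c)) (cong₂ _⊕_ (sgn-inverse c) (sgn-∘ σ c)) ⟩
  sgn c ⊕ (sgn σ ⊕ sgn c)           ≡⟨ cong (sgn c ⊕_) (⊕-comm (sgn σ) (sgn c)) ⟩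
  sgn c ⊕ (sgn c ⊕ sgn σ)           ≡⟨ sym (⊕-assoc (sgn c) (sgn c) (sgn σ)) ⟩
  (sgn c ⊕ sgn c) ⊕ sgn σ           ≡⟨ cong (_⊕ sgn σ) (p+p≡0ℙ (sgn c)) ⟩
  sgn σ ∎

parity≡0⇒2∣ : ∀ m → parity m ≡ 0ℙ → 2 ∣ m
parity≡0⇒2∣ zero          _  = divides 0 refl
parity≡0⇒2∣ (suc (suc m)) eq with parity≡0⇒2∣ m eq
... | divides k m≡k*2 = divides (suc k) (cong (λ x → suc (suc x)) m≡k*2)

2∣⇒parity≡0 : ∀ {m} → 2 ∣ m → parity m ≡ 0ℙ
2∣⇒parity≡0 (divides k refl) = trans (*-homo-* k 2) (⊛-zeroʳ (parity k))

even⇒sgn≡0 : (σ : Perm n) → IsEven σ → sgn σ ≡ 0ℙ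
even⇒sgn≡0 σ even = subst (λ m → parity m ≡ 0ℙ) (inversions≡Inv σ) (2∣⇒parity≡0 even)

sgn≡0⇒even : (σ : Perm n) → sgn σ ≡ 0ℙ → IsEven σ
sgn≡0⇒even σ sgn≡0 = parity≡0⇒2∣ _ (trans (cong parity (inversions≡Inv σ)) sgn≡0)

even-id : IsEven (P.id {n})
even-id {n} = sgn≡0⇒even (P.id {n}) (sgn-id {n})

even-∘ : (σ τ : Perm n) → IsEven σ → IsEven τ → IsEven (σ ∘ₚ τ)
even-∘ σ τ eσ eτ = sgn≡0⇒even (σ ∘ₚ τ) (trans (sgn-∘ σ τ) (cong₂ _⊕_ (even⇒sgn≡0 σ eσ) (even⇒sgn≡0 τ eτ)))

even-inverse : (σ : Perm n) → IsEven σ → IsEven (σ ⁻¹)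
even-inverse σ eσ = sgn≡0⇒even (σ ⁻¹) (trans (sgn-inverse σ) (even⇒sgn≡0 σ eσ))

even-conj : (σ c : Perm n) → IsEven σ → IsEven (σ ^ᶜ c)
even-conj σ c eσ = sgn≡0⇒even (σ ^ᶜ c) (trans (sgn-conj σ c) (even⇒sgn≡0 σ eσ))

insert-at : ∀ {m} (i j : Fin (suc m)) (π : Perm m) → insert i j π ⟨$⟩ʳ i ≡ j
insert-at i j π with i ≟ i
... | yes _   = refl
... | no i≢i = contradiction refl i≢i

-- The transposition (0 1) is odd, lifting preserves the sign, and hence the
-- 3-cycle ρ = (0 2 1) and its lift (1 3 2) are even.
τ₀₁ : Perm (2 + n)
τ₀₁ = transpose 0F 1F

sgn-lift₀ : (τ : Perm n) → sgn (lift₀ τ) ≡ sgn τ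
sgn-lift₀ τ = trans (sgn-remove (lift₀ τ) zero) (sgn-cong (remove zero (lift₀ τ)) τ (λ _ → refl))

sgn-τ₀₁ : sgn (τ₀₁ {n}) ≡ 1ℙ
sgn-τ₀₁ {n} = trans (sgn-remove (τ₀₁ {n}) zero)
  (cong (1ℙ ⊕_) (trans (sgn-cong (remove zero τ₀₁) P.id fixes) (sgn-id {suc n})))
  where
  fixes : remove zero (τ₀₁ {n}) ≈ₚ P.id
  fixes zero    = refl
  fixes (suc j) = refl

τ₀₁-involutive : (τ₀₁ {n} ∘ₚ τ₀₁) ≈ₚ P.id
τ₀₁-involutive zero          = refl
τ₀₁-involutive (suc zero)    = refl
τ₀₁-involutive (suc (suc i)) = refl

ρ : Perm (3 + n)
ρ = τ₀₁ ∘ₚ lift₀ τ₀₁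

even-ρ : IsEven (ρ {n})
even-ρ {n} = sgn≡0⇒even (ρ {n}) (begin
  sgn (ρ {n})                               ≡⟨ sgn-∘ (τ₀₁ {suc n}) (lift₀ (τ₀₁ {n})) ⟩
  sgn (τ₀₁ {suc n}) ⊕ sgn (lift₀ (τ₀₁ {n}))
    ≡⟨ cong₂ _⊕_ (sgn-τ₀₁ {suc n}) (trans (sgn-lift₀ (τ₀₁ {n})) (sgn-τ₀₁ {n})) ⟩
  0ℙ ∎)

even-lift₀ρ : IsEven (lift₀ (ρ {n}))
even-lift₀ρ {n} = sgn≡0⇒even (lift₀ (ρ {n})) (trans (sgn-lift₀ (ρ {n})) (even⇒sgn≡0 (ρ {n}) (even-ρ {n})))

sending-to-0-3 : {i j : Fin (4 + m)} → j ≢ i → Σ (Perm (4 + m)) λ σ → σ ⟨$⟩ʳ 0F ≡ j × σ ⟨$⟩ʳ 3F ≡ i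
sending-to-0-3 {m} {i} {j} j≢i = σ , insert-at 0F j τ , (begin
  σ ⟨$⟩ʳ punchIn 0F 2F                                ≡⟨ insert-punchIn 0F j τ 2F ⟩
  punchIn j (τ ⟨$⟩ʳ 2F)                               ≡⟨ cong (punchIn j) (insert-at 2F (punchOut j≢i) P.id) ⟩
  punchIn j (punchOut j≢i)                            ≡⟨ punchIn-punchOut j≢i ⟩
  i ∎)
  where
  τ : Perm (3 + m)
  τ = insert 2F (punchOut j≢i) P.id
  σ : Perm (4 + m)
  σ = insert 0F j τ

ρ^σ-fixes : (σ : Perm (4 + m)) → (ρ ^ᶜ σ) ⟨$⟩ʳ (σ ⟨$⟩ʳ 3F) ≡ σ ⟨$⟩ʳ 3F
ρ^σ-fixes σ = cong (λ a → σ ⟨$⟩ʳ (ρ ⟨$⟩ʳ a)) (inverseˡ σ)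

ρ^σ-moves : (σ : Perm (4 + m)) → (ρ ^ᶜ σ) ⟨$⟩ʳ (σ ⟨$⟩ʳ 0F) ≢ σ ⟨$⟩ʳ 0F
ρ^σ-moves σ eq = 2≢0 (permute-injective σ (trans (sym (cong (λ a → σ ⟨$⟩ʳ (ρ ⟨$⟩ʳ a)) (inverseˡ σ))) eq))
  where
  2≢0 : 2F ≢ 0F
  2≢0 ()

-- For n ≥ 4, two distinct points j ≠ i can be separated by an even
-- permutation fixing i and moving j, namely a conjugate of ρ.
separating-even : {i j : Fin (4 + m)} → j ≢ i →
  Σ (Perm (4 + m)) λ y → IsEven y × y ⟨$⟩ʳ i ≡ i × y ⟨$⟩ʳ j ≢ j
separating-even {m} j≢i with sending-to-0-3 j≢i
... | σ , refl , refl = ρ ^ᶜ σ , even-conj ρ σ (even-ρ {suc m}) , ρ^σ-fixes σ , ρ^σ-moves σ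

centralizer-trivial : (d : Perm (4 + m)) →
  (∀ y → IsEven y → ∀ i → d ⟨$⟩ʳ (y ⟨$⟩ʳ i) ≡ y ⟨$⟩ʳ (d ⟨$⟩ʳ i)) → d ≈ₚ P.id
centralizer-trivial d commutes i with d ⟨$⟩ʳ i ≟ i
... | yes di≡i = di≡i
... | no di≢i with separating-even di≢i
...   | y , even-y , y-fixes-i , y-moves-di = contradiction (begin
  y ⟨$⟩ʳ (d ⟨$⟩ʳ i)   ≡⟨ sym (commutes y even-y i) ⟩
  d ⟨$⟩ʳ (y ⟨$⟩ʳ i)   ≡⟨ cong (d ⟨$⟩ʳ_) y-fixes-i ⟩
  d ⟨$⟩ʳ i ∎) y-moves-di

-- For n ≥ 4 no permutation d inverts every even permutation by conjugation,
-- i.e. d ∘ y = y⁻¹ ∘ d cannot hold for all y ∈ A_n: applied to y, z and their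
-- product it would force y⁻¹z⁻¹ = z⁻¹y⁻¹, which fails for y = ρ, z = lift₀ ρ.
no-inverting-conjugation : (d : Perm (4 + m)) →
  ¬ (∀ y → IsEven y → ∀ i → d ⟨$⟩ʳ (y ⟨$⟩ʳ i) ≡ y ⟨$⟩ˡ (d ⟨$⟩ʳ i))
no-inverting-conjugation {m} d inverts = 1≢2 (begin
  Y ⟨$⟩ˡ (Z ⟨$⟩ˡ 0F)                    ≡⟨ cong (λ a → Y ⟨$⟩ˡ (Z ⟨$⟩ˡ a)) (sym dj≡0) ⟩
  Y ⟨$⟩ˡ (Z ⟨$⟩ˡ (d ⟨$⟩ʳ j))            ≡⟨ cong (Y ⟨$⟩ˡ_) (sym (inverts Z (even-lift₀ρ {m}) j)) ⟩
  Y ⟨$⟩ˡ (d ⟨$⟩ʳ (Z ⟨$⟩ʳ j))            ≡⟨ sym (inverts Y (even-ρ {suc m}) (Z ⟨$⟩ʳ j)) ⟩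
  d ⟨$⟩ʳ (Y ⟨$⟩ʳ (Z ⟨$⟩ʳ j))            ≡⟨ inverts (Z ∘ₚ Y) (even-∘ Z Y (even-lift₀ρ {m}) (even-ρ {suc m})) j ⟩
  Z ⟨$⟩ˡ (Y ⟨$⟩ˡ (d ⟨$⟩ʳ j))            ≡⟨ cong (λ a → Z ⟨$⟩ˡ (Y ⟨$⟩ˡ a)) dj≡0 ⟩
  Z ⟨$⟩ˡ (Y ⟨$⟩ˡ 0F) ∎)
  where
  Y Z : Perm (4 + m)
  Y = ρ
  Z = lift₀ ρ
  j : Fin (4 + m)
  j = d ⟨$⟩ˡ 0F
  dj≡0 : d ⟨$⟩ʳ j ≡ 0F
  dj≡0 = inverseʳ d
  1≢2 : Fin.suc {3 + m} 0F ≢ 2F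
  1≢2 ()

-- Adjacency in the Cayley graph Γ(S_n, derangements): the quotient is a derangement.
Adjacent : Perm n → Perm n → Set
Adjacent σ τ = ∀ i → σ ⟨$⟩ʳ i ≢ τ ⟨$⟩ʳ i

record IsCoordAut (f : Perm n → Perm n) : Set where
  field
    congruent       : ∀ x y → x ≈ₚ y → f x ≈ₚ f y
    injective  : ∀ x y → f x ≈ₚ f y → x ≈ₚ y
    even       : ∀ x → IsEven x → IsEven (f x)
    surjective : ∀ y → IsEven y → Σ (Perm n) λ x → IsEven x × f x ≈ₚ y
    adjacent   : ∀ x y → Adjacent x y → Adjacent (f x) (f y)
    adjacent⁻  : ∀ x y → Adjacent (f x) (f y) → Adjacent x y

id-aut : IsCoordAut (id {A = Perm n})
id-aut = record
  { congruent = λ _ _ eq → eq ; injective = λ _ _ eq → eq ; even = λ _ e → e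
  ; surjective = λ y e → y , e , (λ _ → refl)
  ; adjacent = λ _ _ a → a ; adjacent⁻ = λ _ _ a → a }

∘-aut : {f g : Perm n → Perm n} → IsCoordAut f → IsCoordAut g → IsCoordAut (g ∘ f)
∘-aut {f = f} {g} F G = record
  { congruent       = λ x y eq → G.congruent (f x) (f y) (F.congruent x y eq)
  ; injective  = λ x y eq → F.injective x y (G.injective (f x) (f y) eq)
  ; even       = λ x e → G.even (f x) (F.even x e)
  ; surjective = surjective
  ; adjacent   = λ x y a → G.adjacent (f x) (f y) (F.adjacent x y a)
  ; adjacent⁻  = λ x y a → F.adjacent⁻ x y (G.adjacent⁻ (f x) (f y) a) }
  where
  module F = IsCoordAut F
  module G = IsCoordAut G
  surjective : ∀ z → IsEven z → Σ (Perm _) λ x → IsEven x × g (f x) ≈ₚ z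
  surjective z ez with G.surjective z ez
  ... | y , ey , gy≈z with F.surjective y ey
  ...   | x , ex , fx≈y = x , ex , λ i → trans (G.congruent (f x) y fx≈y i) (gy≈z i)

shift-aut : (g : Perm n) → IsEven g → IsCoordAut (_∘ₚ g)
shift-aut g even-g = record
  { congruent       = λ x y eq i → cong (g ⟨$⟩ʳ_) (eq i)
  ; injective  = λ x y eq i → permute-injective g (eq i)
  ; even       = λ x e → even-∘ x g e even-g
  ; surjective = λ y e → y ∘ₚ (g ⁻¹) , even-∘ y (g ⁻¹) e (even-inverse g even-g) , λ i → inverseʳ g
  ; adjacent   = λ x y a i → a i ∘ permute-injective g
  ; adjacent⁻  = λ x y a i → a i ∘ cong (g ⟨$⟩ʳ_) }

conj-aut : (c : Perm n) → IsCoordAut (_^ᶜ c)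
conj-aut c = record
  { congruent       = λ x y eq i → cong (c ⟨$⟩ʳ_) (eq (c ⟨$⟩ˡ i))
  ; injective  = λ x y eq i → begin
      x ⟨$⟩ʳ i                       ≡⟨ cong (x ⟨$⟩ʳ_) (sym (inverseˡ c)) ⟩
      x ⟨$⟩ʳ (c ⟨$⟩ˡ (c ⟨$⟩ʳ i))     ≡⟨ permute-injective c (eq (c ⟨$⟩ʳ i)) ⟩
      y ⟨$⟩ʳ (c ⟨$⟩ˡ (c ⟨$⟩ʳ i))     ≡⟨ cong (y ⟨$⟩ʳ_) (inverseˡ c) ⟩
      y ⟨$⟩ʳ i ∎
  ; even       = λ x e → even-conj x c e
  ; surjective = λ y e → y ^ᶜ (c ⁻¹) , even-conj y (c ⁻¹) e , λ i → begin
      c ⟨$⟩ʳ (c ⟨$⟩ˡ (y ⟨$⟩ʳ (c ⟨$⟩ʳ (c ⟨$⟩ˡ i))))  ≡⟨ inverseʳ c ⟩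
      y ⟨$⟩ʳ (c ⟨$⟩ʳ (c ⟨$⟩ˡ i))                    ≡⟨ cong (y ⟨$⟩ʳ_) (inverseʳ c) ⟩
      y ⟨$⟩ʳ i ∎
  ; adjacent   = λ x y a i → a (c ⟨$⟩ˡ i) ∘ permute-injective c
  ; adjacent⁻  = λ x y a i eq → a (c ⟨$⟩ʳ i) (begin
      c ⟨$⟩ʳ (x ⟨$⟩ʳ (c ⟨$⟩ˡ (c ⟨$⟩ʳ i)))  ≡⟨ cong (λ j → c ⟨$⟩ʳ (x ⟨$⟩ʳ j)) (inverseˡ c) ⟩
      c ⟨$⟩ʳ (x ⟨$⟩ʳ i)                  ≡⟨ cong (c ⟨$⟩ʳ_) eq ⟩
      c ⟨$⟩ʳ (y ⟨$⟩ʳ i)                  ≡⟨ cong (λ j → c ⟨$⟩ʳ (y ⟨$⟩ʳ j)) (sym (inverseˡ c)) ⟩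
      c ⟨$⟩ʳ (y ⟨$⟩ʳ (c ⟨$⟩ˡ (c ⟨$⟩ʳ i))) ∎) }

inverse-aut : IsCoordAut (_⁻¹ {n})
inverse-aut = record
  { congruent  = λ x y eq i → begin
      x ⟨$⟩ˡ i                        ≡⟨ sym (inverseˡ y) ⟩
      y ⟨$⟩ˡ (y ⟨$⟩ʳ (x ⟨$⟩ˡ i))      ≡⟨ cong (y ⟨$⟩ˡ_) (sym (eq (x ⟨$⟩ˡ i))) ⟩
      y ⟨$⟩ˡ (x ⟨$⟩ʳ (x ⟨$⟩ˡ i))      ≡⟨ cong (y ⟨$⟩ˡ_) (inverseʳ x) ⟩
      y ⟨$⟩ˡ i ∎
  ; injective  = λ x y eq i → begin
      x ⟨$⟩ʳ i                        ≡⟨ sym (inverseʳ y) ⟩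
      y ⟨$⟩ʳ (y ⟨$⟩ˡ (x ⟨$⟩ʳ i))      ≡⟨ cong (y ⟨$⟩ʳ_) (sym (eq (x ⟨$⟩ʳ i))) ⟩
      y ⟨$⟩ʳ (x ⟨$⟩ˡ (x ⟨$⟩ʳ i))      ≡⟨ cong (y ⟨$⟩ʳ_) (inverseˡ x) ⟩
      y ⟨$⟩ʳ i ∎
  ; even       = even-inverse
  ; surjective = λ y e → y ⁻¹ , even-inverse y e , λ _ → refl
  ; adjacent   = λ x y a i eq → a (x ⟨$⟩ˡ i) (begin
      x ⟨$⟩ʳ (x ⟨$⟩ˡ i)               ≡⟨ inverseʳ x ⟩
      i                               ≡⟨ sym (inverseʳ y) ⟩
      y ⟨$⟩ʳ (y ⟨$⟩ˡ i)               ≡⟨ cong (y ⟨$⟩ʳ_) (sym eq) ⟩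
      y ⟨$⟩ʳ (x ⟨$⟩ˡ i) ∎)
  ; adjacent⁻  = λ x y a i eq → a (x ⟨$⟩ʳ i) (begin
      x ⟨$⟩ˡ (x ⟨$⟩ʳ i)               ≡⟨ inverseˡ x ⟩
      i                               ≡⟨ sym (inverseˡ y) ⟩
      y ⟨$⟩ˡ (y ⟨$⟩ʳ i)               ≡⟨ cong (y ⟨$⟩ˡ_) (sym eq) ⟩
      y ⟨$⟩ˡ (x ⟨$⟩ʳ i) ∎) }

invertIf : Bool → Perm n → Perm n
invertIf e σ = if e then σ ⁻¹ else σ

invertIf-aut : (e : Bool) → IsCoordAut (invertIf {n} e)
invertIf-aut true  = inverse-aut
invertIf-aut false = id-aut

coord : Bool → Perm n → Perm n → Perm n → Perm n
coord e c g = invertIf e ∘ (_^ᶜ c) ∘ (_∘ₚ g)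

coord-aut : (e : Bool) (c g : Perm n) → IsEven g → IsCoordAut (coord e c g)
coord-aut e c g even-g = ∘-aut (∘-aut (shift-aut g even-g) (conj-aut c)) (invertIf-aut e)

reindex : ∀ {q} (π : Perm q) (P : Fin q → Set) → (∀ k → P (π ⟨$⟩ʳ k)) → ∀ l → P l
reindex π P h l = subst P (inverseʳ π) (h (π ⟨$⟩ˡ l))

coordinatewise : ∀ {q} → (Fin q → Perm n → Perm n) → Perm q → Tup n q → Tup n q
coordinatewise F π x k = F k (x (π ⟨$⟩ʳ k))

coordinatewise-aut : ∀ {q} (F : Fin q → Perm n → Perm n) (π : Perm q) →
  (∀ k → IsCoordAut (F k)) → IsAutAΓ (coordinatewise F π)
coordinatewise-aut {n} {q} F π F-aut =
    (λ x ex k → even (F-aut k) (x (π ⟨$⟩ʳ k)) (ex (π ⟨$⟩ʳ k)))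
  , (λ x y _ _ x≈y k → congruent (F-aut k) (x (π ⟨$⟩ʳ k)) (y (π ⟨$⟩ʳ k)) (x≈y (π ⟨$⟩ʳ k)))
  , (λ x y _ _ fx≈fy → reindex π (λ l → x l ≈ₚ y l)
        (λ k → injective (F-aut k) (x (π ⟨$⟩ʳ k)) (y (π ⟨$⟩ʳ k)) (fx≈fy k)))
  , surjective′
  , λ x y _ _ → (λ a k → adjacent (F-aut k) (x (π ⟨$⟩ʳ k)) (y (π ⟨$⟩ʳ k)) (a (π ⟨$⟩ʳ k)))
              , (λ a → reindex π (λ l → Adjacent (x l) (y l))
                   (λ k → adjacent⁻ (F-aut k) (x (π ⟨$⟩ʳ k)) (y (π ⟨$⟩ʳ k)) (a k)))
  where
  open IsCoordAut
  surjective′ : ∀ y → InAq y → Σ (Tup n q) λ x → InAq x × coordinatewise F π x ≈ᵗ y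
  surjective′ y ey = x , (λ l → proj₁ (proj₂ (preimage (π ⟨$⟩ˡ l)))) , hits
    where
    preimage : ∀ k → Σ (Perm n) λ z → IsEven z × F k z ≈ₚ y k
    preimage k = surjective (F-aut k) (y k) (ey k)
    x : Tup n q
    x l = proj₁ (preimage (π ⟨$⟩ˡ l))
    hits : coordinatewise F π x ≈ᵗ y
    hits k = subst (λ k′ → F k′ (x (π ⟨$⟩ʳ k)) ≈ₚ y k′) (inverseˡ π)
                   (proj₂ (proj₂ (preimage (π ⟨$⟩ˡ (π ⟨$⟩ʳ k)))))

coords : ∀ {q} → Param n q → Fin q → Perm n → Perm n
coords p k = coord (Param.ε p k) (Param.c p (Param.π p ⟨$⟩ʳ k)) (Param.g p (Param.π p ⟨$⟩ʳ k))

act-aut : ∀ {q} (p : Param n q) → IsAutAΓ (act p)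
act-aut p = coordinatewise-aut (coords p) (Param.π p)
  (λ k → coord-aut (Param.ε p k) (Param.c p (Param.π p ⟨$⟩ʳ k)) (Param.g p (Param.π p ⟨$⟩ʳ k))
           (Param.g-even p (Param.π p ⟨$⟩ʳ k)))

-- For e = true the inversion turns the shift g′ into a left factor, which is
-- absorbed into the conjugator.
∘-conj : Bool → (c g c′ g′ : Perm n) → Perm n
∘-conj false c g c′ g′ = c ∘ₚ c′
∘-conj true  c g c′ g′ = c ∘ₚ (g′ ∘ₚ c′)

∘-shift : Bool → (c g c′ g′ : Perm n) → Perm n
∘-shift false c g c′ g′ = g ∘ₚ (g′ ^ᶜ (c ⁻¹))
∘-shift true  c g c′ g′ = g ∘ₚ ((g′ ⁻¹) ^ᶜ (c ⁻¹))

even-∘-shift : ∀ e (c g c′ g′ : Perm n) → IsEven g → IsEven g′ → IsEven (∘-shift e c g c′ g′)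
even-∘-shift false c g c′ g′ eg eg′ = even-∘ g (g′ ^ᶜ (c ⁻¹)) eg (even-conj g′ (c ⁻¹) eg′)
even-∘-shift true  c g c′ g′ eg eg′ = even-∘ g ((g′ ⁻¹) ^ᶜ (c ⁻¹)) eg (even-conj (g′ ⁻¹) (c ⁻¹) (even-inverse g′ eg′))

invertIf-inverse : ∀ e (σ : Perm n) → invertIf e (σ ⁻¹) ≈ₚ invertIf (not e) σ
invertIf-inverse true  σ i = refl
invertIf-inverse false σ i = refl

coord-∘ : ∀ e e′ (c g c′ g′ y : Perm n) →
  coord e′ c′ g′ (coord e c g y) ≈ₚ coord (e xor e′) (∘-conj e c g c′ g′) (∘-shift e c g c′ g′) y
coord-∘ false e′ c g c′ g′ y = congruent (invertIf-aut e′) _ _ λ i →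
  cong (c′ ⟨$⟩ʳ_) (sym (inverseʳ c))
  where open IsCoordAut
coord-∘ true e′ c g c′ g′ y i =
  trans (congruent (invertIf-aut e′) _ (((y ∘ₚ G) ^ᶜ C) ⁻¹) inner i) (invertIf-inverse e′ _ i)
  where
  open IsCoordAut
  C G : Perm _
  C = ∘-conj true c g c′ g′
  G = ∘-shift true c g c′ g′
  inner : ((coord true c g y ∘ₚ g′) ^ᶜ c′) ≈ₚ (((y ∘ₚ G) ^ᶜ C) ⁻¹)
  inner i = cong (λ z → c′ ⟨$⟩ʳ (g′ ⟨$⟩ʳ (c ⟨$⟩ʳ (y ⟨$⟩ˡ (g ⟨$⟩ˡ (c ⟨$⟩ˡ z))))))
    (sym (trans (cong (g′ ⟨$⟩ʳ_) (inverseʳ c)) (inverseʳ g′)))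



-- The parameter of the composite "first p, then p′"; the coordinate data of p″
-- at position l = (k^π′)^π combines that of p at l with that of p′ at k^π′ = l^π⁻¹.
compose : ∀ {q} → Param n q → Param n q → Param n q
compose {q = q} (param g eg c π ε) (param g′ eg′ c′ π′ ε′) =
  param (λ l → ∘-shift (ε (π⁻¹ l)) (c l) (g l) (c′ (π⁻¹ l)) (g′ (π⁻¹ l)))
        (λ l → even-∘-shift (ε (π⁻¹ l)) (c l) (g l) (c′ (π⁻¹ l)) (g′ (π⁻¹ l)) (eg l) (eg′ (π⁻¹ l)))
        (λ l → ∘-conj (ε (π⁻¹ l)) (c l) (g l) (c′ (π⁻¹ l)) (g′ (π⁻¹ l)))
        (π′ ∘ₚ π)
        (λ k → ε (π′ ⟨$⟩ʳ k) xor ε′ k)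
  where
  π⁻¹ : Fin q → Fin q
  π⁻¹ l = π ⟨$⟩ˡ l

act-compose : ∀ {q} (p p′ : Param n q) → act (compose p p′) ≈ᶠ (act p′ ∘ act p)
act-compose (param g eg c π ε) (param g′ eg′ c′ π′ ε′) x _ k i = begin
  coordAt (π ⟨$⟩ˡ l) ⟨$⟩ʳ i
    ≡⟨ cong (λ m → coordAt m ⟨$⟩ʳ i) (inverseˡ π) ⟩
  coordAt (π′ ⟨$⟩ʳ k) ⟨$⟩ʳ i
    ≡⟨ sym (coord-∘ (ε (π′ ⟨$⟩ʳ k)) (ε′ k) (c l) (g l) (c′ (π′ ⟨$⟩ʳ k)) (g′ (π′ ⟨$⟩ʳ k)) (x l) i) ⟩
  act (param g′ eg′ c′ π′ ε′) (act (param g eg c π ε) x) k ⟨$⟩ʳ i ∎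
  where
  l : Fin _
  l = π ⟨$⟩ʳ (π′ ⟨$⟩ʳ k)
  coordAt : Fin _ → Perm _
  coordAt m = coord (ε (π′ ⟨$⟩ʳ k) xor ε′ k) (∘-conj (ε m) (c l) (g l) (c′ m) (g′ m))
                    (∘-shift (ε m) (c l) (g l) (c′ m) (g′ m)) (x l)

coord-cong : ∀ {e e′} (c g y c′ g′ y′ : Perm n) → e ≡ e′ → c ≈ₚ c′ → g ≈ₚ g′ → y ≈ₚ y′ →
  coord e c g y ≈ₚ coord e′ c′ g′ y′
coord-cong {e = e} c g y c′ g′ y′ refl c≈c′ g≈g′ y≈y′ =
  IsCoordAut.congruent (invertIf-aut e) ((y ∘ₚ g) ^ᶜ c) ((y′ ∘ₚ g′) ^ᶜ c′) λ i → begin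
    c ⟨$⟩ʳ (g ⟨$⟩ʳ (y ⟨$⟩ʳ (c ⟨$⟩ˡ i)))
      ≡⟨ cong (λ z → c ⟨$⟩ʳ (g ⟨$⟩ʳ (y ⟨$⟩ʳ z))) (IsCoordAut.congruent inverse-aut c c′ c≈c′ i) ⟩
    c ⟨$⟩ʳ (g ⟨$⟩ʳ (y ⟨$⟩ʳ (c′ ⟨$⟩ˡ i)))     ≡⟨ c≈c′ _ ⟩
    c′ ⟨$⟩ʳ (g ⟨$⟩ʳ (y ⟨$⟩ʳ (c′ ⟨$⟩ˡ i)))    ≡⟨ cong (c′ ⟨$⟩ʳ_) (g≈g′ _) ⟩
    c′ ⟨$⟩ʳ (g′ ⟨$⟩ʳ (y ⟨$⟩ʳ (c′ ⟨$⟩ˡ i)))   ≡⟨ cong (λ z → c′ ⟨$⟩ʳ (g′ ⟨$⟩ʳ z)) (y≈y′ _) ⟩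
    c′ ⟨$⟩ʳ (g′ ⟨$⟩ʳ (y′ ⟨$⟩ʳ (c′ ⟨$⟩ˡ i))) ∎

tuple-at : ∀ {q} (t t′ : Tup n q) → t ≈ᵗ t′ → {l l′ : Fin q} → l ≡ l′ → t l ≈ₚ t′ l′
tuple-at t t′ t≈t′ refl = t≈t′ _

record SameParam {q} (p p′ : Param n q) : Set where
  field
    same-π : Param.π p ≈ₚ Param.π p′
    same-ε : ∀ k → Param.ε p k ≡ Param.ε p′ k
    same-c : Param.c p ≈ᵗ Param.c p′
    same-g : Param.g p ≈ᵗ Param.g p′

act-cong : ∀ {q} (p p′ : Param n q) → SameParam p p′ → act p ≈ᶠ act p′
act-cong (param g eg c π ε) (param g′ eg′ c′ π′ ε′) same x _ k =
  coord-cong (c (π ⟨$⟩ʳ k)) (g (π ⟨$⟩ʳ k)) (x (π ⟨$⟩ʳ k)) (c′ (π′ ⟨$⟩ʳ k)) (g′ (π′ ⟨$⟩ʳ k)) (x (π′ ⟨$⟩ʳ k))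
    (same-ε k) (tuple-at c c′ same-c (same-π k)) (tuple-at g g′ same-g (same-π k))
    (tuple-at x x (λ _ _ → refl) (same-π k))
  where open SameParam same


-- Write f(y) = (y g)^c and
-- f′(y) = (y g′)^c′.  Comparing f(y) with f(id) shows that if f = f′ on A_n then
-- c′⁻¹c centralizes A_n, so c = c′ and then g = g′.
shift-conj-determined : (c g c′ g′ : Perm (4 + m)) →
  (∀ y → IsEven y → ((y ∘ₚ g) ^ᶜ c) ≈ₚ ((y ∘ₚ g′) ^ᶜ c′)) → c ≈ₚ c′ × g ≈ₚ g′
shift-conj-determined {m} c g c′ g′ agree = c≈c′ , g≈g′
  where
  at-id : ∀ i → c ⟨$⟩ʳ (g ⟨$⟩ʳ (c ⟨$⟩ˡ i)) ≡ c′ ⟨$⟩ʳ (g′ ⟨$⟩ʳ (c′ ⟨$⟩ˡ i))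
  at-id = agree P.id (even-id {4 + m})

  E : Perm (4 + m)
  E = c ∘ₚ (c′ ⁻¹)

  E-central : ∀ y → IsEven y → ∀ j → E ⟨$⟩ʳ (y ⟨$⟩ʳ j) ≡ y ⟨$⟩ʳ (E ⟨$⟩ʳ j)
  E-central y even-y j = begin
    c′ ⟨$⟩ˡ (c ⟨$⟩ʳ (y ⟨$⟩ʳ j))                    ≡⟨ cong (λ z → c′ ⟨$⟩ˡ (c ⟨$⟩ʳ z)) y-j ⟩
    c′ ⟨$⟩ˡ (c ⟨$⟩ʳ (c ⟨$⟩ˡ (c′ ⟨$⟩ʳ (y ⟨$⟩ʳ w)))) ≡⟨ cong (c′ ⟨$⟩ˡ_) (inverseʳ c) ⟩
    c′ ⟨$⟩ˡ (c′ ⟨$⟩ʳ (y ⟨$⟩ʳ w))                   ≡⟨ inverseˡ c′ ⟩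
    y ⟨$⟩ʳ w ∎
    where
    w : Fin (4 + m)
    w = E ⟨$⟩ʳ j
    -- both sides below equal c′ (g′ (y w)), by the hypothesis at y and at id
    y-j : y ⟨$⟩ʳ j ≡ c ⟨$⟩ˡ (c′ ⟨$⟩ʳ (y ⟨$⟩ʳ w))
    y-j = permute-injective g (permute-injective c (begin
      c ⟨$⟩ʳ (g ⟨$⟩ʳ (y ⟨$⟩ʳ j))
        ≡⟨ cong (λ z → c ⟨$⟩ʳ (g ⟨$⟩ʳ (y ⟨$⟩ʳ z))) (sym (inverseˡ c)) ⟩
      c ⟨$⟩ʳ (g ⟨$⟩ʳ (y ⟨$⟩ʳ (c ⟨$⟩ˡ (c ⟨$⟩ʳ j))))     ≡⟨ agree y even-y (c ⟨$⟩ʳ j) ⟩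
      c′ ⟨$⟩ʳ (g′ ⟨$⟩ʳ (y ⟨$⟩ʳ w))                     ≡⟨ cong (λ z → c′ ⟨$⟩ʳ (g′ ⟨$⟩ʳ z)) (sym (inverseˡ c′)) ⟩
      c′ ⟨$⟩ʳ (g′ ⟨$⟩ʳ (c′ ⟨$⟩ˡ (c′ ⟨$⟩ʳ (y ⟨$⟩ʳ w)))) ≡⟨ sym (at-id _) ⟩
      c ⟨$⟩ʳ (g ⟨$⟩ʳ (c ⟨$⟩ˡ (c′ ⟨$⟩ʳ (y ⟨$⟩ʳ w)))) ∎))

  c≈c′ : c ≈ₚ c′
  c≈c′ j = trans (sym (inverseʳ c′)) (cong (c′ ⟨$⟩ʳ_) (centralizer-trivial E E-central j))

  g≈g′ : g ≈ₚ g′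
  g≈g′ j = permute-injective c (begin
    c ⟨$⟩ʳ (g ⟨$⟩ʳ j)                   ≡⟨ cong (λ z → c ⟨$⟩ʳ (g ⟨$⟩ʳ z)) (sym (inverseˡ c)) ⟩
    c ⟨$⟩ʳ (g ⟨$⟩ʳ (c ⟨$⟩ˡ (c ⟨$⟩ʳ j)))  ≡⟨ at-id (c ⟨$⟩ʳ j) ⟩
    c′ ⟨$⟩ʳ (g′ ⟨$⟩ʳ (E ⟨$⟩ʳ j))
      ≡⟨ cong (λ z → c′ ⟨$⟩ʳ (g′ ⟨$⟩ʳ z)) (centralizer-trivial E E-central j) ⟩
    c′ ⟨$⟩ʳ (g′ ⟨$⟩ʳ j)                 ≡⟨ sym (c≈c′ _) ⟩
    c ⟨$⟩ʳ (g′ ⟨$⟩ʳ j) ∎)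

-- For n ≥ 4, y ↦ (y g)^c never agrees on A_n with y ↦ ((y g′)^c′)⁻¹: otherwise
-- D = c′⁻¹ ∘ c ∘ g (as functions) would invert every even permutation by conjugation.
shift-conj-not-inverted : (c g c′ g′ : Perm (4 + m)) →
  ¬ (∀ y → IsEven y → ((y ∘ₚ g) ^ᶜ c) ≈ₚ (((y ∘ₚ g′) ^ᶜ c′) ⁻¹))
shift-conj-not-inverted {m} c g c′ g′ agree = no-inverting-conjugation D D-inverts
  where
  D : Perm (4 + m)
  D = g ∘ₚ (c ∘ₚ (c′ ⁻¹))

  agree-at : ∀ y → IsEven y → ∀ j → D ⟨$⟩ʳ (y ⟨$⟩ʳ j) ≡ y ⟨$⟩ˡ (g′ ⟨$⟩ˡ (c′ ⟨$⟩ˡ (c ⟨$⟩ʳ j)))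
  agree-at y even-y j = begin
    c′ ⟨$⟩ˡ (c ⟨$⟩ʳ (g ⟨$⟩ʳ (y ⟨$⟩ʳ j)))
      ≡⟨ cong (λ z → c′ ⟨$⟩ˡ (c ⟨$⟩ʳ (g ⟨$⟩ʳ (y ⟨$⟩ʳ z)))) (sym (inverseˡ c)) ⟩
    c′ ⟨$⟩ˡ (c ⟨$⟩ʳ (g ⟨$⟩ʳ (y ⟨$⟩ʳ (c ⟨$⟩ˡ (c ⟨$⟩ʳ j)))))
      ≡⟨ cong (c′ ⟨$⟩ˡ_) (agree y even-y (c ⟨$⟩ʳ j)) ⟩
    c′ ⟨$⟩ˡ (c′ ⟨$⟩ʳ (y ⟨$⟩ˡ (g′ ⟨$⟩ˡ (c′ ⟨$⟩ˡ (c ⟨$⟩ʳ j)))))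
      ≡⟨ inverseˡ c′ ⟩
    y ⟨$⟩ˡ (g′ ⟨$⟩ˡ (c′ ⟨$⟩ˡ (c ⟨$⟩ʳ j))) ∎

  D-inverts : ∀ y → IsEven y → ∀ j → D ⟨$⟩ʳ (y ⟨$⟩ʳ j) ≡ y ⟨$⟩ˡ (D ⟨$⟩ʳ j)
  D-inverts y even-y j = trans (agree-at y even-y j) (cong (y ⟨$⟩ˡ_) (sym (agree-at P.id (even-id {4 + m}) j)))

coord-determined : ∀ e e′ (c g c′ g′ : Perm (4 + m)) →
  (∀ y → IsEven y → coord e c g y ≈ₚ coord e′ c′ g′ y) → e ≡ e′ × c ≈ₚ c′ × g ≈ₚ g′
coord-determined false false c g c′ g′ agree = refl , shift-conj-determined c g c′ g′ agree
coord-determined true  true  c g c′ g′ agree = refl , shift-conj-determined c g c′ g′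
  (λ y even-y → IsCoordAut.injective inverse-aut ((y ∘ₚ g) ^ᶜ c) ((y ∘ₚ g′) ^ᶜ c′) (agree y even-y))
coord-determined false true  c g c′ g′ agree = contradiction agree (shift-conj-not-inverted c g c′ g′)
coord-determined true  false c g c′ g′ agree =
  contradiction (λ y even-y i → sym (agree y even-y i)) (shift-conj-not-inverted c′ g′ c g)

coords-aut : ∀ {q} (p : Param n q) (k : Fin q) → IsCoordAut (coords p k)
coords-aut p k = coord-aut (Param.ε p k) (Param.c p (Param.π p ⟨$⟩ʳ k)) (Param.g p (Param.π p ⟨$⟩ʳ k))
  (Param.g-even p (Param.π p ⟨$⟩ʳ k))

single : ∀ {q} → Fin q → Perm n → Tup n q
single l y l′ with l′ ≟ l
... | yes _ = y
... | no  _ = P.id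

single-here : ∀ {q} {l l′ : Fin q} (y : Perm n) → l′ ≡ l → single l y l′ ≈ₚ y
single-here {l = l} y refl i with l ≟ l
... | yes _   = refl
... | no l≢l = contradiction refl l≢l

single-there : ∀ {q} {l l′ : Fin q} (y : Perm n) → l′ ≢ l → single l y l′ ≈ₚ P.id
single-there {l = l} {l′} y l′≢l i with l′ ≟ l
... | yes l′≡l = contradiction l′≡l l′≢l
... | no  _    = refl

even-single : ∀ {q} (l : Fin q) (y : Perm n) → IsEven y → InAq (single l y)
even-single {n} l y even-y l′ with l′ ≟ l
... | yes _ = even-y
... | no  _ = even-id {n}

probe : ∀ {q} (p p′ : Param n q) → act p ≈ᶠ act p′ → ∀ k l y → IsEven y →
  coords p k (single l y (Param.π p ⟨$⟩ʳ k)) ≈ₚ coords p′ k (single l y (Param.π p′ ⟨$⟩ʳ k))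
probe p p′ same-act k l y even-y = same-act (single l y) (even-single l y even-y) k

-- The coordinate permutation is determined (n ≥ 4): if l = k^π differed from
-- k^π′, coordinate k of act p would see the 3-cycle ρ placed in coordinate l,
-- while that of act p′ would only see the identity.
act-determines-π : ∀ {q} (p p′ : Param (4 + m) q) → act p ≈ᶠ act p′ → Param.π p ≈ₚ Param.π p′
act-determines-π {m} p p′ same-act k with Param.π p ⟨$⟩ʳ k ≟ Param.π p′ ⟨$⟩ʳ k
... | yes eq = eq
... | no  ne = contradiction (sym (IsCoordAut.injective (coords-aut p k) ρ′ P.id ρ≈id 0F)) 0≢2
  where
  open IsCoordAut
  l : Fin _
  l = Param.π p ⟨$⟩ʳ k
  ρ′ : Perm (4 + m)
  ρ′ = ρ
  ρ≈id : coords p k ρ′ ≈ₚ coords p k P.id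
  ρ≈id i = begin
    coords p k ρ′ ⟨$⟩ʳ i
      ≡⟨ congruent (coords-aut p k) (single l ρ′ l) ρ′ (single-here {l = l} {l} ρ′ refl) i ⟨
    coords p k (single l ρ′ l) ⟨$⟩ʳ i
      ≡⟨ probe p p′ same-act k l ρ′ (even-ρ {suc m}) i ⟩
    coords p′ k (single l ρ′ (Param.π p′ ⟨$⟩ʳ k)) ⟨$⟩ʳ i
      ≡⟨ congruent (coords-aut p′ k) (single l ρ′ (Param.π p′ ⟨$⟩ʳ k)) P.id
                   (single-there {l = l} {Param.π p′ ⟨$⟩ʳ k} ρ′ (ne ∘ sym)) i ⟩
    coords p′ k P.id ⟨$⟩ʳ i
      ≡⟨ same-act (λ _ → P.id) (λ _ → even-id {4 + m}) k i ⟨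
    coords p k P.id ⟨$⟩ʳ i ∎
  0≢2 : 0F ≢ 2F
  0≢2 ()

-- Once k^π = k^π′ = l, coordinate k of act p and of act p′ are the coordinate
-- maps of the data at l, and they agree on A_n; so coord-determined applies.
act-determines-coordinate : ∀ {q} (p p′ : Param (4 + m) q) → act p ≈ᶠ act p′ →
  ∀ k → let l = Param.π p ⟨$⟩ʳ k in Param.π p′ ⟨$⟩ʳ k ≡ l →
  Param.ε p k ≡ Param.ε p′ k × Param.c p l ≈ₚ Param.c p′ l × Param.g p l ≈ₚ Param.g p′ l
act-determines-coordinate p@(param g eg c π ε) p′@(param g′ eg′ c′ π′ ε′) same-act k π′k≡l =
  coord-determined (ε k) (ε′ k) (c l) (g l) (c′ l) (g′ l) λ y even-y i → begin
    coords p k y ⟨$⟩ʳ i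
      ≡⟨ IsCoordAut.congruent (coords-aut p k) (single l y l) y (single-here {l = l} {l} y refl) i ⟨
    coords p k (single l y l) ⟨$⟩ʳ i
      ≡⟨ probe p p′ same-act k l y even-y i ⟩
    coords p′ k (single l y (π′ ⟨$⟩ʳ k)) ⟨$⟩ʳ i
      ≡⟨ coord-cong {e = ε′ k} (c′ (π′ ⟨$⟩ʳ k)) (g′ (π′ ⟨$⟩ʳ k)) (single l y (π′ ⟨$⟩ʳ k)) (c′ l) (g′ l) y refl
           (tuple-at c′ c′ (λ _ _ → refl) π′k≡l) (tuple-at g′ g′ (λ _ _ → refl) π′k≡l)
           (single-here {l = l} {π′ ⟨$⟩ʳ k} y π′k≡l) i ⟩
    coord (ε′ k) (c′ l) (g′ l) y ⟨$⟩ʳ i ∎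
  where
  l : Fin _
  l = π ⟨$⟩ʳ k

act-faithful : ∀ {q} (p p′ : Param (4 + m) q) → act p ≈ᶠ act p′ → SameParam p p′
act-faithful p@(param g eg c π ε) p′@(param g′ eg′ c′ π′ ε′) same-act = record
  { same-π = same-π
  ; same-ε = λ k → proj₁ (same-at k)
  ; same-c = reindex π (λ l → c l ≈ₚ c′ l) (λ k → proj₁ (proj₂ (same-at k)))
  ; same-g = reindex π (λ l → g l ≈ₚ g′ l) (λ k → proj₂ (proj₂ (same-at k)))
  }
  where
  same-π : π ≈ₚ π′
  same-π = act-determines-π p p′ same-act
  same-at : ∀ k → ε k ≡ ε′ k × c (π ⟨$⟩ʳ k) ≈ₚ c′ (π ⟨$⟩ʳ k) × g (π ⟨$⟩ʳ k) ≈ₚ g′ (π ⟨$⟩ʳ k)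
  same-at k = act-determines-coordinate p p′ same-act k (sym (same-π k))

record Enumeration (N : ℕ) {A : Set} (_≈_ : A → A → Set) : Set where
  field
    elem      : Fin N → A
    injective : ∀ i j → elem i ≈ elem j → i ≡ j
    complete  : ∀ a → Σ (Fin N) λ i → a ≈ elem i

enum-map : ∀ {N} {A B : Set} {_≈A_ : A → A → Set} {_≈B_ : B → B → Set} →
  Enumeration N _≈A_ → (f : A → B) →
  (∀ a a′ → a ≈A a′ → f a ≈B f a′) → (∀ a a′ → f a ≈B f a′ → a ≈A a′) →
  (∀ b → Σ A λ a → b ≈B f a) → (∀ {x y z} → x ≈B y → y ≈B z → x ≈B z) →
  Enumeration N _≈B_
enum-map E f preserves reflects onto ≈B-trans = record
  { elem      = f ∘ elem
  ; injective = λ i j fi≈fj → injective i j (reflects (elem i) (elem j) fi≈fj)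
  ; complete  = λ b → let a , b≈fa = onto b ; i , a≈i = complete a
                      in i , ≈B-trans b≈fa (preserves a (elem i) a≈i) }
  where open Enumeration E

enum-Fin : ∀ {N} → Enumeration N (_≡_ {A = Fin N})
enum-Fin = record { elem = id ; injective = λ _ _ eq → eq ; complete = λ i → i , refl }

enum-× : ∀ {a b} {A B : Set} {_≈A_ : A → A → Set} {_≈B_ : B → B → Set} →
  Enumeration a _≈A_ → Enumeration b _≈B_ → Enumeration (a * b) (Pointwise _≈A_ _≈B_)
enum-× {a} {b} {_≈A_ = _≈A_} {_≈B_} EA EB = record
  { elem      = λ k → EA.elem (proj₁ (remQuot {a} b k)) , EB.elem (proj₂ (remQuot {a} b k))
  ; injective = λ k k′ (≈₁ , ≈₂) → begin
      k                                   ≡⟨ combine-remQuot {a} b k ⟨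
      uncurry combine (remQuot {a} b k)
        ≡⟨ cong₂ combine (EA.injective (proj₁ (remQuot {a} b k)) (proj₁ (remQuot {a} b k′)) ≈₁)
                                                  (EB.injective (proj₂ (remQuot {a} b k)) (proj₂ (remQuot {a} b k′)) ≈₂) ⟩
      uncurry combine (remQuot {a} b k′)  ≡⟨ combine-remQuot {a} b k′ ⟩
      k′ ∎
  ; complete  = λ (x , y) → let i , x≈i = EA.complete x ; j , y≈j = EB.complete y
      in combine i j , subst (λ (i′ , j′) → x ≈A EA.elem i′ × y ≈B EB.elem j′)
                             (sym (remQuot-combine {a} {b} i j)) (x≈i , y≈j) }
  where
  module EA = Enumeration EA
  module EB = Enumeration EB

funToFin-cong : ∀ {a q} (f f′ : Fin q → Fin a) → (∀ k → f k ≡ f′ k) → funToFin f ≡ funToFin f′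
funToFin-cong {q = zero}  f f′ f≗f′ = refl
funToFin-cong {q = suc q} f f′ f≗f′ = cong₂ combine (f≗f′ zero) (funToFin-cong (f ∘ suc) (f′ ∘ suc) (f≗f′ ∘ suc))

enum-→ : ∀ {a q} {A : Set} {_≈_ : A → A → Set} →
  Enumeration a _≈_ → Enumeration (a ^ q) (λ (f f′ : Fin q → A) → ∀ k → f k ≈ f′ k)
enum-→ {a} {q} {_≈_ = _≈_} E = record
  { elem      = λ v k → elem (finToFun {a} {q} v k)
  ; injective = λ v v′ v≈v′ → begin
      v                        ≡⟨ funToFin-finToFin {q} {a} v ⟨
      funToFin (finToFun {a} {q} v)
        ≡⟨ funToFin-cong (finToFun v) (finToFun v′) (λ k → injective _ _ (v≈v′ k)) ⟩
      funToFin (finToFun {a} {q} v′)   ≡⟨ funToFin-finToFin {q} {a} v′ ⟩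
      v′ ∎
  ; complete  = λ f → funToFin (λ k → proj₁ (complete (f k))) , λ k →
      subst (λ i → f k ≈ elem i) (sym (finToFun-funToFin (λ k → proj₁ (complete (f k))) k))
            (proj₂ (complete (f k)))
  }
  where open Enumeration E

insert-cong : ∀ {m} (i j : Fin (suc m)) (σ τ : Perm m) → σ ≈ₚ τ → insert i j σ ≈ₚ insert i j τ
insert-cong i j σ τ σ≈τ k with i ≟ k
... | yes _ = refl
... | no  _ = cong (punchIn j) (σ≈τ _)

remove-cong : ∀ {m} (i : Fin (suc m)) (σ τ : Perm (suc m)) → σ ≈ₚ τ → remove i σ ≈ₚ remove i τ
remove-cong i σ τ σ≈τ j = punchOut-equal (σ≈τ i) (σ≈τ (punchIn i j))
  where
  punchOut-equal : ∀ {a a′ b b′ : Fin (suc _)} {a≢b : a ≢ b} {a′≢b′ : a′ ≢ b′} →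
    a ≡ a′ → b ≡ b′ → punchOut a≢b ≡ punchOut a′≢b′
  punchOut-equal {a = a} refl refl = punchOut-cong a refl

-- Permutations: a permutation of Fin (suc n) is the image r of 0 together with
-- a permutation of the remaining n points, so Fin (suc n !) ≅ Fin (suc n) × Fin (n !).
enum-Perm : ∀ n → Enumeration (n !) (_≈ₚ_ {n})
enum-Perm zero = record
  { elem = λ _ → P.id ; injective = λ { zero zero _ → refl } ; complete = λ σ → zero , λ () }
enum-Perm (suc n) = enum-map (enum-× enum-Fin (enum-Perm n)) (λ (r , τ) → insert 0F r τ)
  (λ (r , τ) (r′ , τ′) (r≡r′ , τ≈τ′) →
     subst (λ r″ → insert 0F r τ ≈ₚ insert 0F r″ τ′) r≡r′ (insert-cong 0F r τ τ′ τ≈τ′))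
  (λ (r , τ) (r′ , τ′) same →
       trans (sym (insert-at 0F r τ)) (trans (same 0F) (insert-at 0F r′ τ′))
     , λ j → trans (sym (remove-insert 0F r τ j))
               (trans (remove-cong 0F (insert 0F r τ) (insert 0F r′ τ′) same j) (remove-insert 0F r′ τ′ j)))
  (λ σ → (σ ⟨$⟩ʳ 0F , remove 0F σ) , λ i → sym (insert-remove 0F σ i))
  (λ x≈y y≈z i → trans (x≈y i) (y≈z i))

-- Encoding a pair (g, ε) with g even by the single permutation g τ₀₁^ε, whose
-- sign is ε: this identifies A_n × Z_2 with S_n.
odd? : Parity → Bool
odd? 0ℙ = false
odd? 1ℙ = true

twist : Bool → Perm (2 + n) → Perm (2 + n)
twist false s = s
twist true  s = s ∘ₚ τ₀₁

twist-cong : ∀ {e e′} (s s′ : Perm (2 + n)) → e ≡ e′ → s ≈ₚ s′ → twist e s ≈ₚ twist e′ s′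
twist-cong {e = false} s s′ refl s≈s′ = s≈s′
twist-cong {e = true}  s s′ refl s≈s′ i = cong (τ₀₁ ⟨$⟩ʳ_) (s≈s′ i)

twist-involutive : ∀ e (s : Perm (2 + n)) → twist e (twist e s) ≈ₚ s
twist-involutive false s i = refl
twist-involutive true  s i = τ₀₁-involutive (s ⟨$⟩ʳ i)

even-untwist : (s : Perm (2 + n)) → IsEven (twist (odd? (sgn s)) s)
even-untwist {n} s with sgn s in sgn-s
... | 0ℙ = sgn≡0⇒even s sgn-s
... | 1ℙ = sgn≡0⇒even (s ∘ₚ τ₀₁) (trans (sgn-∘ s τ₀₁) (cong₂ _⊕_ sgn-s (sgn-τ₀₁ {n})))

odd?-twist : ∀ e (g : Perm (2 + n)) → IsEven g → odd? (sgn (twist e g)) ≡ e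
odd?-twist {n} false g even-g = cong odd? (even⇒sgn≡0 g even-g)
odd?-twist {n} true  g even-g = cong odd? (trans (sgn-∘ g τ₀₁) (cong₂ _⊕_ (even⇒sgn≡0 g even-g) (sgn-τ₀₁ {n})))

Code : ℕ → ℕ → Set
Code n q = Perm q × (Tup n q × Tup n q)

_≈code_ : ∀ {q} → Code n q → Code n q → Set
_≈code_ = Pointwise _≈ₚ_ (Pointwise _≈ᵗ_ _≈ᵗ_)

decode : ∀ {q} → Code (2 + n) q → Param (2 + n) q
decode (π , c , s) =
  param (λ k → twist (odd? (sgn (s k))) (s k)) (λ k → even-untwist (s k)) c π (λ k → odd? (sgn (s k)))

decode-preserves : ∀ {q} (a a′ : Code (2 + n) q) → a ≈code a′ → act (decode a) ≈ᶠ act (decode a′)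
decode-preserves (π , c , s) (π′ , c′ , s′) (π≈π′ , c≈c′ , s≈s′) =
  act-cong (decode (π , c , s)) (decode (π′ , c′ , s′)) record
    { same-π = π≈π′
    ; same-ε = flag
    ; same-c = c≈c′
    ; same-g = λ k → twist-cong (s k) (s′ k) (flag k) (s≈s′ k)
    }
  where
  flag : ∀ k → odd? (sgn (s k)) ≡ odd? (sgn (s′ k))
  flag k = cong odd? (sgn-cong (s k) (s′ k) (s≈s′ k))

decode-reflects : ∀ {q} (a a′ : Code (4 + m) q) → act (decode a) ≈ᶠ act (decode a′) → a ≈code a′
decode-reflects {m} (π , c , s) (π′ , c′ , s′) same-act = same-π , same-c , λ k i → begin
  s k ⟨$⟩ʳ i                         ≡⟨ twist-involutive (odd? (sgn (s k))) (s k) i ⟨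
  twist (ε k) (g k) ⟨$⟩ʳ i           ≡⟨ twist-cong (g k) (g′ k) (same-ε k) (same-g k) i ⟩
  twist (ε′ k) (g′ k) ⟨$⟩ʳ i         ≡⟨ twist-involutive (odd? (sgn (s′ k))) (s′ k) i ⟩
  s′ k ⟨$⟩ʳ i ∎
  where
  open SameParam (act-faithful {m} (decode (π , c , s)) (decode (π′ , c′ , s′)) same-act)
  open Param (decode (π , c , s)) using (g; ε)
  open Param (decode (π′ , c′ , s′)) using () renaming (g to g′; ε to ε′)

decode-onto : ∀ {q} (p : Param (2 + n) q) → Σ (Code (2 + n) q) λ a → act p ≈ᶠ act (decode a)
decode-onto p@(param g eg c π ε) = code , act-cong p (decode code) record
  { same-π = λ _ → refl
  ; same-ε = λ k → sym (flag k)
  ; same-c = λ _ _ → refl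
  ; same-g = λ k i → sym (trans (twist-cong (twist (ε k) (g k)) (twist (ε k) (g k)) (flag k) (λ _ → refl) i)
                                (twist-involutive (ε k) (g k) i))
  }
  where
  code : Code (2 + _) _
  code = π , c , λ k → twist (ε k) (g k)
  flag : ∀ k → odd? (sgn (twist (ε k) (g k))) ≡ ε k
  flag k = odd?-twist (ε k) (g k) (eg k)

enum-act : ∀ m q → Enumeration (q ! * ((4 + m) !) ^ (2 * q)) (λ (p p′ : Param (4 + m) q) → act p ≈ᶠ act p′)
enum-act m q = subst (λ N → Enumeration N (λ (p p′ : Param (4 + m) q) → act p ≈ᶠ act p′)) count
  (enum-map (enum-× (enum-Perm q) (enum-× (enum-→ (enum-Perm (4 + m))) (enum-→ (enum-Perm (4 + m)))))
     decode decode-preserves decode-reflects decode-onto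
     (λ f≈g g≈h x ex k i → trans (f≈g x ex k i) (g≈h x ex k i)))
  where
  N! : ℕ
  N! = (4 + m) !
  count : q ! * (N! ^ q * N! ^ q) ≡ q ! * N! ^ (2 * q)
  count = cong (q ! *_) (trans (sym (^-distribˡ-+-* N! q q)) (cong (λ e → N! ^ (q + e)) (sym (+-identityʳ q))))

lemma4p3 : (n q : ℕ) → n ≥ 5 → q ≥ 1 →
    (∀ (p : Param n q) → IsAutAΓ (act p)) ×
    (∀ (p p′ : Param n q) → Σ (Param n q) (λ p″ → act p″ ≈ᶠ (act p′ ∘ act p))) ×
    Σ (Fin (q ! * (n !) ^ (2 * q)) → Param n q)
      (λ e → (∀ i j → act (e i) ≈ᶠ act (e j) → i ≡ j) ×
             (∀ (p : Param n q) → Σ (Fin (q ! * (n !) ^ (2 * q))) (λ i → act p ≈ᶠ act (e i))))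
lemma4p3 (suc (suc (suc (suc (suc m))))) q (s≤s (s≤s (s≤s (s≤s (s≤s z≤n))))) _ =
    act-aut
  , (λ p p′ → compose p p′ , act-compose p p′)
  , elem , injective , complete
  where open Enumeration (enum-act (suc m) q)
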